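{- Let $\pi_1^*=(u_1,\dots,u_l)$ be a directed path in $G_1^*$ from $v_\alpha$ to $v_\beta$ with the minimum number of color-switches, let $j^1<\dots<j^\lambda$ be the indices of its color-switching vertices, and set $j^0=1$, $j^{\lambda+1}=l$. For $0\le h\le\lambda$ let $z^h$ be the (common) color of the edges of $\pi_1^*$ between $u_{j^h}$ and $u_{j^{h+1}}$, and let $\pi(h)$ be a directed path in $G_{z^h}^*$ from $u_{j^h}$ to $u_{j^{h+1}}$ having the minimum number of switches. Then for every $0\le h\le\lambda$, $\pi(h)$ has no switch, i.e., it consists only of $0$-edges or only of $1$-edges.
   Context: Pairwise disjoint finite sets $P_1,\dots,P_\ell$ ($\ell\ge2$) with equal sizes, a metric $d$ on $\Omega=\bigcup_iP_i$, integer $k>0$. A balanced clustering partitions $\Omega$ into at most $k$ clusters $X$ with $|X\cap P_1|=\dots=|X\cap P_\ell|$; optimal means minimum sum of radii $r(Q)=\min_{p\in\Omega}\max_{q\in Q}d(p,q)$. For $2\le i\le\ell$, $M_i$ is a minimum-weight perfect matching between $P_1$ and $P_i$ (weights $d$), $M=\bigcup_iM_i$. Fix an optimal balanced clustering $\mathcal C^*$ and merge: while an edge of $M$ joins two different current clusters, replace them by their union. Let $\hat C$ be one resulting cluster and $C_1^*,\dots,C_\tau^*$ the clusters of $\mathcal C^*$ whose union is $\hat C$. The directed multigraph $G_1^*$ has a vertex $v_j$ for each $C_j^*$; for each $\{p,q\}\in M$ with $p\in P_1\cap C_i^*$, $q\in P_z\cap C_j^*$, $i\ne j$, there is a $0$-edge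 of color $z$ from $v_i$ to $v_j$, and for each $\{p,q\}\in M$ with $p\in P_z\cap C_i^*$, $q\in P_1\cap C_j^*$ a $1$-edge of color $z$ from $v_i$ to $v_j$, each of weight $d(p,q)$. $G_z^*$ is the subgraph of $G_1^*$ formed by the edges of color $z$. A directed path is a sequence of distinct vertices with a chosen edge between consecutive ones; consecutive edges form a color-switch if their colors differ and a switch if one is a $0$-edge and the other a $1$-edge; a color-switching vertex is the common vertex of two consecutive edges forming a color-switch. -}

module Defs where

open import Data.Nat using (ℕ; zero; suc; _+_; _≤_; s≤s)
open import Data.Fin using (Fin; zero; suc) renaming (_≟_ to _≟ᶠ_)
open import Data.Fin.Permutation using (Permutation′; _⟨$⟩ʳ_)
open import Data.Product using (Σ; ∃; _×_; _,_)
open import Data.Bool using (Bool; true; false; if_then_else_)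
open import Data.List using (List; []; _∷_; foldr; map; filter; length; allFin; cartesianProduct; _++_; _∷ʳ_)
open import Data.List.Relation.Unary.All using (All)
open import Data.List.Relation.Unary.Unique.Propositional using (Unique)
open import Relation.Nullary using (¬_; does)
open import Relation.Binary.PropositionalEquality using (_≡_; _≢_)
open import Relation.Binary.Structures using (IsDecTotalOrder)
open import Relation.Binary.Construct.Closure.ReflexiveTransitive using (Star)
open import Algebra.Structures using (IsCommutativeMonoid)
open import Function.Bundles using (_⇔_)
open import Data.Unit using (⊤)

-- Value domain of the metric.  The paper uses real numbers; we work
-- over an arbitrary linearly ordered commutative monoid (ℝ with +, 0, ≤
-- is an instance), since agda-stdlib has no reals.

record Scale : Set₁ where
  field
    W       : Set
    _≤ʷ_    : W → W → Set
    _+ʷ_    : W → W → W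
    0ʷ      : W
    isDecTotalOrder      : IsDecTotalOrder _≡_ _≤ʷ_
    isCommutativeMonoid  : IsCommutativeMonoid _≡_ _+ʷ_ 0ʷ
    +-mono  : ∀ {x y} z → x ≤ʷ y → (x +ʷ z) ≤ʷ (y +ʷ z)

  open IsDecTotalOrder isDecTotalOrder using (_≤?_)

  _⊔ʷ_ : W → W → W
  x ⊔ʷ y = if does (x ≤? y) then y else x

  _⊓ʷ_ : W → W → W
  x ⊓ʷ y = if does (x ≤? y) then x else y

  sumʷ : List W → W
  sumʷ = foldr _+ʷ_ 0ʷ

  -- maximum of a list (0 for the empty list; distances are ≥ 0)
  maxʷ : List W → W
  maxʷ = foldr _⊔ʷ_ 0ʷ

  minʷ : W → List W → W
  minʷ d [] = d
  minʷ d (x ∷ xs) = foldr _⊓ʷ_ x xs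

first : ∀ {ℓ} → 2 ≤ ℓ → Fin ℓ
first {suc _} (s≤s _) = zero

-- The setting.  Ω = P₁ ∪ … ∪ P_ℓ is encoded as Fin ℓ × Fin n: the
-- point (i , a) is the a-th point of P_i (so the P_i are pairwise
-- disjoint of common size n).

module Setting (S : Scale) (ℓ n k : ℕ) (ℓ≥2 : 2 ≤ ℓ) where
  open Scale S

  Ω : Set
  Ω = Fin ℓ × Fin n

  P₁ : Fin ℓ
  P₁ = first ℓ≥2

  allΩ : List Ω
  allΩ = cartesianProduct (allFin ℓ) (allFin n)

  record IsMetric (d : Ω → Ω → W) : Set where
    field
      nonneg   : ∀ p q → 0ʷ ≤ʷ d p q
      zero⇔eq  : ∀ p q → (d p q ≡ 0ʷ) ⇔ (p ≡ q)
      symmetric : ∀ p q → d p q ≡ d q p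
      triangle : ∀ p q r → d p r ≤ʷ (d p q +ʷ d q r)

  -- A clustering into at most k clusters: a labelling of Ω by Fin k
  -- (cluster c = the set of points labelled c; empty labels are not
  -- clusters).
  Clustering : Set
  Clustering = Ω → Fin k

  members : Clustering → Fin k → List Ω
  members cl c = filter (λ p → cl p ≟ᶠ c) allΩ

  count : Clustering → Fin k → Fin ℓ → ℕ
  count cl c i = length (filter (λ a → cl (i , a) ≟ᶠ c) (allFin n))

  Balanced : Clustering → Set
  Balanced cl = ∀ c i j → count cl c i ≡ count cl c j

  module _ (d : Ω → Ω → W) where

    radius : List Ω → W
    radius Q = minʷ 0ʷ (map (λ p → maxʷ (map (d p) Q)) allΩ)

    -- sum of radii (an empty label contributes r(∅) = 0)
    cost : Clustering → W
    cost cl = sumʷ (map (λ c → radius (members cl c)) (allFin k))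

    OptimalBalanced : Clustering → Set
    OptimalBalanced cl = Balanced cl × (∀ cl′ → Balanced cl′ → cost cl ≤ʷ cost cl′)

    -- a perfect matching between P₁ and P_z, as a bijection
    -- σ : Fin n → Fin n (point (P₁ , a) is matched to (z , σ a))
    matchWeight : Fin ℓ → Permutation′ n → W
    matchWeight z σ = sumʷ (map (λ a → d (P₁ , a) (z , σ ⟨$⟩ʳ a)) (allFin n))

    MinWeightMatching : Fin ℓ → Permutation′ n → Set
    MinWeightMatching z σ = ∀ τ → matchWeight z σ ≤ʷ matchWeight z τ

  -- The multigraph G₁*, given the clustering cl = 𝒞* and the matchings
  -- σ z (= M_z for z ≠ P₁).  Vertices are cluster labels.

  module Graph (cl : Clustering) (σ : Fin ℓ → Permutation′ n) where

    -- An edge: a matching edge {p , q} of M_z (p = (P₁ , a),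
    -- q = (z , σ z a)) joining different clusters, together with its
    -- type: false = 0-edge (from cl p to cl q), true = 1-edge
    -- (from cl q to cl p).
    record Edge : Set where
      constructor edge
      field
        color : Fin ℓ
        color≢P₁ : color ≢ P₁
        pt    : Fin n
        kind  : Bool
        differ : cl (P₁ , pt) ≢ cl (color , σ color ⟨$⟩ʳ pt)

    open Edge public

    pEnd qEnd : Edge → Ω
    pEnd e = (P₁ , pt e)
    qEnd e = (color e , σ (color e) ⟨$⟩ʳ pt e)

    src tgt : Edge → Fin k
    src e = if kind e then cl (qEnd e) else cl (pEnd e)
    tgt e = if kind e then cl (pEnd e) else cl (qEnd e)

    weight : (Ω → Ω → W) → Edge → W
    weight d e = d (pEnd e) (qEnd e)

    Adj : Fin k → Fin k → Set
    Adj c c′ = Σ Edge λ e → src e ≡ c × tgt e ≡ c′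

    -- The merging process ends with the connected components: the
    -- merged cluster Ĉ containing 𝒞*-cluster c₀ consists of the
    -- clusters reachable from c₀ along edges of M.
    InĈ : Fin k → Fin k → Set
    InĈ c₀ c = Star Adj c₀ c

    data Walk : Fin k → List Edge → Fin k → Set where
      stop : ∀ {u} → Walk u [] u
      step : ∀ {u w e es} → src e ≡ u → Walk (tgt e) es w → Walk u (e ∷ es) w

    vertices : Fin k → List Edge → List (Fin k)
    vertices u [] = u ∷ []
    vertices u (e ∷ es) = u ∷ vertices (tgt e) es

    record Path (c₀ : Fin k) (Allowed : Edge → Set) (u w : Fin k) : Set where
      field
        edges    : List Edge
        walk     : Walk u edges w
        allowed  : All Allowed edges
        inĈ      : All (InĈ c₀) (vertices u edges)
        distinct : Unique (vertices u edges)

    open Path public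

    -- G₁* : all edges;  G_z* : edges of color z.
    AnyEdge : Edge → Set
    AnyEdge _ = ⊤

    ColorIs : Fin ℓ → Edge → Set
    ColorIs z e = color e ≡ z

    colorSwitches : List Edge → ℕ
    colorSwitches [] = 0
    colorSwitches (e ∷ []) = 0
    colorSwitches (e ∷ e′ ∷ es) =
      (if does (color e ≟ᶠ color e′) then 0 else 1) + colorSwitches (e′ ∷ es)

    sameKind : Bool → Bool → Bool
    sameKind false false = true
    sameKind true  true  = true
    sameKind _     _     = false

    switches : List Edge → ℕ
    switches [] = 0
    switches (e ∷ []) = 0
    switches (e ∷ e′ ∷ es) =
      (if sameKind (kind e) (kind e′) then 0 else 1) + switches (e′ ∷ es)

    -- seg is a maximal monochromatic block of colour z in pre ++ seg ++ post,
    -- i.e. the edges between two consecutive vertices of the sequence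
    -- u_1 = u_{j^0}, u_{j^1}, …, u_{j^λ}, u_{j^{λ+1}} = u_l.
    MaximalBlock : List Edge → List Edge → List Edge → Fin ℓ → Set
    MaximalBlock pre seg post z =
      (seg ≢ []) ×
      All (ColorIs z) seg ×
      (∀ pre′ e → pre ≡ pre′ ∷ʳ e → color e ≢ z) ×
      (∀ e post′ → post ≡ e ∷ post′ → color e ≢ z)

-- Fix a color z.  Every cluster
-- contains as many points of P₁ as of P_z, and M_z is a bijection, so a set
-- of clusters closed under the 0-edges of color z (from a point of P₁ to
-- its partner in P_z) is also closed under their reversals, the 1-edges of
-- color z: otherwise it would contain more points of P_z than of P₁.
-- Applied to the clusters reachable by 0-edges, this turns every 1-edge of
-- color z into a walk of 0-edges of color z.  Hence any walk in G_z* from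
-- u to w becomes a walk of 0-edges, whose shortcut is a path in G_z*
-- without switches; a path with the minimum number of switches has none.
module Submission where

open import Defs
open import Data.Bool using (true; false; if_then_else_)
open import Data.Fin using (Fin; zero; suc; _≟_)
open import Data.Fin.Permutation using (Permutation′; _⟨$⟩ʳ_)
open import Data.List using (List; []; _∷_; _++_; filter; length; tabulate; allFin)
open import Data.List.Relation.Unary.All as All using (All; []; _∷_)
open import Data.List.Relation.Unary.All.Properties using (++⁺)
open import Data.List.Relation.Unary.All.Properties.Core using (¬Any⇒All¬)
open import Data.List.Relation.Unary.AllPairs using ([]; _∷_)
open import Data.List.Relation.Unary.Any using (here; there)
open import Data.List.Relation.Unary.Unique.Propositional using (Unique)
open import Data.Nat using (ℕ; zero; suc; _+_; _*_; _≤_; z≤n; _≤?_)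
open import Data.Nat.Properties
  using (≤-refl; ≤-antisym; +-mono-≤; +-monoʳ-≤; +-cancelʳ-≤; +-cancelˡ-≡;
         +-identityʳ; *-identityʳ; *-zeroʳ; n≤0⇒n≡0; +-*-semiring; module ≤-Reasoning)
open import Algebra.Properties.Semiring.Sum +-*-semiring
  using (sum; sum-syntax; sum-cong-≗; sum-replicate-zero; ∑-comm; *-distribˡ-sum; ∑-permute)
open import Data.Product using (Σ; _×_; _,_; proj₁; proj₂)
open import Effect.Monad using (RawMonad)
open import Function using (id; _∘_)
open import Level using (0ℓ)
open import Relation.Binary.Construct.Closure.ReflexiveTransitive using (ε; _◅_; _◅◅_)
open import Relation.Binary.PropositionalEquality
  using (_≡_; _≢_; refl; sym; trans; cong; cong₂; subst; module ≡-Reasoning)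
open import Relation.Nullary using (¬_; Dec; yes; no; does; contradiction)
open import Relation.Nullary.Decidable using (decidable-stable; ¬¬-excluded-middle)
open import Relation.Nullary.Negation using (¬¬-Monad)
open import Relation.Unary using (Pred; Decidable)

open RawMonad (¬¬-Monad {0ℓ}) using (pure; _>>=_)

𝟙 : {P : Set} → Dec P → ℕ
𝟙 P? = if does P? then 1 else 0

𝟙-mono : {P Q : Set} (P? : Dec P) (Q? : Dec Q) → (P → Q) → 𝟙 P? ≤ 𝟙 Q?
𝟙-mono (no _)  _       _   = z≤n
𝟙-mono (yes _) (yes _) _   = ≤-refl
𝟙-mono (yes p) (no ¬q) P⇒Q = contradiction (P⇒Q p) ¬q

𝟙-reflects : {P Q : Set} (P? : Dec P) (Q? : Dec Q) → 𝟙 P? ≡ 𝟙 Q? → Q → P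
𝟙-reflects (yes p) _       _  _ = p
𝟙-reflects (no _)  (no ¬q) _  q = contradiction q ¬q

¬¬-decidable : ∀ {m} (P : Pred (Fin m) 0ℓ) → ¬ ¬ Decidable P
¬¬-decidable {zero}  P = pure λ ()
¬¬-decidable {suc m} P = do
  P₀? ← ¬¬-excluded-middle
  Pₛ? ← ¬¬-decidable (P ∘ suc)
  pure λ { zero → P₀? ; (suc i) → Pₛ? i }

+-≤-≡⇒≡ : ∀ {a b c d} → a ≤ c → b ≤ d → a + b ≡ c + d → a ≡ c × b ≡ d
+-≤-≡⇒≡ {a} {b} {c} {d} a≤c b≤d a+b≡c+d = a≡c , +-cancelˡ-≡ a b d (trans a+b≡c+d (cong (_+ d) (sym a≡c)))
  where
  open ≤-Reasoning
  a≡c : a ≡ c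
  a≡c = ≤-antisym a≤c (+-cancelʳ-≤ b c a (begin
    c + b  ≤⟨ +-monoʳ-≤ c b≤d ⟩
    c + d  ≡⟨ sym a+b≡c+d ⟩
    a + b  ∎))

sum-mono : ∀ {m} (f g : Fin m → ℕ) → (∀ i → f i ≤ g i) → sum f ≤ sum g
sum-mono {zero}  f g f≤g = z≤n
sum-mono {suc m} f g f≤g = +-mono-≤ (f≤g zero) (sum-mono (f ∘ suc) (g ∘ suc) (f≤g ∘ suc))

sum-≤-≡⇒≗ : ∀ {m} (f g : Fin m → ℕ) → (∀ i → f i ≤ g i) → sum f ≡ sum g → ∀ i → f i ≡ g i
sum-≤-≡⇒≗ {zero}  f g f≤g Σf≡Σg ()
sum-≤-≡⇒≗ {suc m} f g f≤g Σf≡Σg = λ where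
    zero    → proj₁ head×tail
    (suc i) → sum-≤-≡⇒≗ (f ∘ suc) (g ∘ suc) (f≤g ∘ suc) (proj₂ head×tail) i
  where
  head×tail : f zero ≡ g zero × sum (f ∘ suc) ≡ sum (g ∘ suc)
  head×tail = +-≤-≡⇒≡ (f≤g zero) (sum-mono (f ∘ suc) (g ∘ suc) (f≤g ∘ suc)) Σf≡Σg

length-filter-tabulate : ∀ {m} {A : Set} {P : Pred A 0ℓ} (P? : Decidable P) (f : Fin m → A) →
                         length (filter P? (tabulate f)) ≡ ∑[ i < m ] 𝟙 (P? (f i))
length-filter-tabulate {zero}  P? f = refl
length-filter-tabulate {suc m} P? f with does (P? (f zero))
... | true  = cong suc (length-filter-tabulate P? (f ∘ suc))
... | false = length-filter-tabulate P? (f ∘ suc)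

sum-select : ∀ {m} (h : Fin m → ℕ) (t : Fin m) → ∑[ c < m ] (h c * 𝟙 (t ≟ c)) ≡ h t
sum-select {suc m} h zero = begin
  h zero * 1 + ∑[ c < m ] (h (suc c) * 0) ≡⟨ cong₂ _+_ (*-identityʳ (h zero)) (sum-cong-≗ (*-zeroʳ ∘ h ∘ suc)) ⟩
  h zero + ∑[ c < m ] 0                  ≡⟨ cong (h zero +_) (sum-replicate-zero m) ⟩
  h zero + 0                             ≡⟨ +-identityʳ (h zero) ⟩
  h zero                                 ∎
  where open ≡-Reasoning
sum-select {suc m} h (suc t) =
  trans (cong (_+ ∑[ c < m ] (h (suc c) * 𝟙 (t ≟ c))) (*-zeroʳ (h zero))) (sum-select (h ∘ suc) t)

∑-𝟙-fibres : ∀ {n k} {R : Pred (Fin k) 0ℓ} (R? : Decidable R) (f : Fin n → Fin k) →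
             ∑[ a < n ] 𝟙 (R? (f a)) ≡ ∑[ c < k ] (𝟙 (R? c) * length (filter (λ a → f a ≟ c) (allFin n)))
∑-𝟙-fibres {n} {k} R? f = begin
  ∑[ a < n ] 𝟙 (R? (f a))                      ≡⟨ sum-cong-≗ (λ a → sum-select (𝟙 ∘ R?) (f a)) ⟨
  ∑[ a < n ] ∑[ c < k ] (𝟙 (R? c) * 𝟙 (f a ≟ c)) ≡⟨ ∑-comm (λ a c → 𝟙 (R? c) * 𝟙 (f a ≟ c)) ⟩
  ∑[ c < k ] ∑[ a < n ] (𝟙 (R? c) * 𝟙 (f a ≟ c)) ≡⟨ sum-cong-≗ (λ c → *-distribˡ-sum (𝟙 (R? c)) (λ a → 𝟙 (f a ≟ c))) ⟨
  ∑[ c < k ] (𝟙 (R? c) * ∑[ a < n ] 𝟙 (f a ≟ c)) ≡⟨ sum-cong-≗ (λ c → cong (𝟙 (R? c) *_) (length-filter-tabulate (λ a → f a ≟ c) id)) ⟨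
  ∑[ c < k ] (𝟙 (R? c) * length (filter (λ a → f a ≟ c) (allFin n)))  ∎
  where open ≡-Reasoning

module Clusters (S : Scale) (ℓ n k : ℕ) (ℓ≥2 : 2 ≤ ℓ) (cl : Setting.Clustering S ℓ n k ℓ≥2) where
  open Setting S ℓ n k ℓ≥2

  balanced⇒∑-𝟙-equal : Balanced cl → {R : Pred (Fin k) 0ℓ} (R? : Decidable R) (i j : Fin ℓ) →
                       ∑[ a < n ] 𝟙 (R? (cl (i , a))) ≡ ∑[ a < n ] 𝟙 (R? (cl (j , a)))
  balanced⇒∑-𝟙-equal balanced R? i j = begin
    ∑[ a < n ] 𝟙 (R? (cl (i , a)))      ≡⟨ ∑-𝟙-fibres R? (λ a → cl (i , a)) ⟩
    ∑[ c < k ] (𝟙 (R? c) * count cl c i) ≡⟨ sum-cong-≗ (λ c → cong (𝟙 (R? c) *_) (balanced c i j)) ⟩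
    ∑[ c < k ] (𝟙 (R? c) * count cl c j) ≡⟨ ∑-𝟙-fibres R? (λ a → cl (j , a)) ⟨
    ∑[ a < n ] 𝟙 (R? (cl (j , a)))      ∎
    where open ≡-Reasoning

  balanced⇒reverse-closed : Balanced cl → (z : Fin ℓ) (π : Permutation′ n) →
    {R : Pred (Fin k) 0ℓ} → Decidable R →
    (∀ a → R (cl (P₁ , a)) → R (cl (z , π ⟨$⟩ʳ a))) →
    ∀ a → R (cl (z , π ⟨$⟩ʳ a)) → R (cl (P₁ , a))
  balanced⇒reverse-closed balanced z π R? closed a =
    𝟙-reflects (R? _) (R? _) (sum-≤-≡⇒≗ _ _ (λ b → 𝟙-mono (R? _) (R? _) (closed b)) same-sums a)
    where
    same-sums : ∑[ b < n ] 𝟙 (R? (cl (P₁ , b))) ≡ ∑[ b < n ] 𝟙 (R? (cl (z , π ⟨$⟩ʳ b)))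
    same-sums = trans (balanced⇒∑-𝟙-equal balanced R? P₁ z) (∑-permute (λ b → 𝟙 (R? (cl (z , b)))) π)

  module G₁ (σ : Fin ℓ → Permutation′ n) where
    open Graph cl σ
    open import Data.List.Membership.DecPropositional (_≟_ {k}) using (_∈_; _∈?_)

    walk-++ : ∀ {u v w es fs} → Walk u es v → Walk v fs w → Walk u (es ++ fs) w
    walk-++ stop           W′ = W′
    walk-++ (step src≡u W) W′ = step src≡u (walk-++ W W′)

    walk-inĈ : ∀ {c₀ u w es} → Walk u es w → InĈ c₀ u → All (InĈ c₀) (vertices u es)
    walk-inĈ stop                  u∈Ĉ = u∈Ĉ ∷ []
    walk-inĈ (step {e = e} refl W) u∈Ĉ = u∈Ĉ ∷ walk-inĈ W (u∈Ĉ ◅◅ ((e , refl , refl) ◅ ε))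

    source-inĈ : ∀ {c₀ u} es → All (InĈ c₀) (vertices u es) → InĈ c₀ u
    source-inĈ []      (u∈Ĉ ∷ _) = u∈Ĉ
    source-inĈ (_ ∷ _) (u∈Ĉ ∷ _) = u∈Ĉ

    SimpleWalk : (Edge → Set) → Fin k → Fin k → Set
    SimpleWalk P u w = Σ (List Edge) λ es → Walk u es w × All P es × Unique (vertices u es)

    simpleWalk-suffix : ∀ {P u v w es} → Walk v es w → u ∈ vertices v es → All P es →
                        Unique (vertices v es) → SimpleWalk P u w
    simpleWalk-suffix stop       (here refl) P       U       = _ , stop , P , U
    simpleWalk-suffix (step s W) (here refl) P       U       = _ , step s W , P , U
    simpleWalk-suffix (step _ W) (there u∈)  (_ ∷ P) (_ ∷ U) = simpleWalk-suffix W u∈ P U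

    shortcut : ∀ {P u w es} → Walk u es w → All P es → SimpleWalk P u w
    shortcut stop [] = [] , stop , [] , [] ∷ []
    shortcut {u = u} (step {e = e} src≡u W) (Pe ∷ P) with shortcut W P
    ... | es′ , W′ , P′ , U′ with u ∈? vertices (tgt e) es′
    ...   | yes u∈ = simpleWalk-suffix W′ u∈ P′ U′
    ...   | no u∉  = e ∷ es′ , step src≡u W′ , Pe ∷ P′ , ¬Any⇒All¬ _ u∉ ∷ U′

    sameKind-reflexive : ∀ {b b′} → b ≡ b′ → sameKind b b′ ≡ true
    sameKind-reflexive {false} refl = refl
    sameKind-reflexive {true}  refl = refl

    uniform-kind⇒switches≡0 : ∀ {b} es → All (λ e → kind e ≡ b) es → switches es ≡ 0
    uniform-kind⇒switches≡0 []            []                 = refl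
    uniform-kind⇒switches≡0 (_ ∷ [])      _                  = refl
    uniform-kind⇒switches≡0 (e ∷ e′ ∷ es) (e≡b ∷ e′≡b ∷ same) =
      cong₂ _+_ (cong (λ s → if s then 0 else 1) (sameKind-reflexive (trans e≡b (sym e′≡b))))
                (uniform-kind⇒switches≡0 (e′ ∷ es) (e′≡b ∷ same))

    ZeroEdge : Fin ℓ → Edge → Set
    ZeroEdge z e = color e ≡ z × kind e ≡ false

    ZeroWalk : Fin ℓ → Fin k → Fin k → Set
    ZeroWalk z u w = Σ (List Edge) λ es → Walk u es w × All (ZeroEdge z) es

    zeroWalk-++ : ∀ {z u v w} → ZeroWalk z u v → ZeroWalk z v w → ZeroWalk z u w
    zeroWalk-++ (es , W , Z) (fs , W′ , Z′) = es ++ fs , walk-++ W W′ , ++⁺ Z Z′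

    zeroWalk-matched : ∀ {z} → z ≢ P₁ → ∀ a → ZeroWalk z (cl (P₁ , a)) (cl (z , σ z ⟨$⟩ʳ a))
    zeroWalk-matched {z} z≢P₁ a with cl (P₁ , a) ≟ cl (z , σ z ⟨$⟩ʳ a)
    ... | yes same  = subst (ZeroWalk z (cl (P₁ , a))) same ([] , stop , [])
    ... | no differ = edge z z≢P₁ a false differ ∷ [] , step refl stop , (refl , refl) ∷ []

    -- Reachability is decidable only under double negation here; the final
    -- goal, an inequality in ℕ, is decidable and discharges it.
    oneEdge⇒¬¬zeroWalk : Balanced cl → ∀ {z} → z ≢ P₁ → ∀ a →
                         ¬ ¬ ZeroWalk z (cl (z , σ z ⟨$⟩ʳ a)) (cl (P₁ , a))
    oneEdge⇒¬¬zeroWalk balanced {z} z≢P₁ a = do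
      reachable? ← ¬¬-decidable (ZeroWalk z (cl (z , σ z ⟨$⟩ʳ a)))
      pure (balanced⇒reverse-closed balanced z (σ z) reachable?
              (λ b reached → zeroWalk-++ reached (zeroWalk-matched z≢P₁ b)) a ([] , stop , []))

    edge⇒¬¬zeroWalk : Balanced cl → ∀ e → ¬ ¬ ZeroWalk (color e) (src e) (tgt e)
    edge⇒¬¬zeroWalk _        e@(edge _ _ _ false _) = pure (e ∷ [] , step refl stop , (refl , refl) ∷ [])
    edge⇒¬¬zeroWalk balanced (edge _ z≢P₁ a true _) = oneEdge⇒¬¬zeroWalk balanced z≢P₁ a

    colorWalk⇒¬¬zeroWalk : Balanced cl → ∀ {z u w es} → Walk u es w → All (ColorIs z) es →
                            ¬ ¬ ZeroWalk z u w
    colorWalk⇒¬¬zeroWalk balanced stop                  []         = pure ([] , stop , [])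
    colorWalk⇒¬¬zeroWalk balanced (step {e = e} refl W) (refl ∷ Z) = do
      first ← edge⇒¬¬zeroWalk balanced e
      rest  ← colorWalk⇒¬¬zeroWalk balanced W Z
      pure (zeroWalk-++ first rest)

    zeroWalk⇒switchFreePath : ∀ {c₀ z u w} → InĈ c₀ u → ZeroWalk z u w →
                              Σ (Path c₀ (ColorIs z) u w) λ π → switches (edges π) ≡ 0
    zeroWalk⇒switchFreePath u∈Ĉ (_ , W , Z) with shortcut W Z
    ... | es , W′ , Z′ , U′ =
      record { edges = es ; walk = W′ ; allowed = All.map proj₁ Z′
             ; inĈ = walk-inĈ W′ u∈Ĉ ; distinct = U′ } ,
      uniform-kind⇒switches≡0 es (All.map proj₂ Z′)

lemma17 : (S : Scale) (ℓ n k : ℕ) (ℓ≥2 : 2 ≤ ℓ)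
    → let open Scale S in
      let open Setting S ℓ n k ℓ≥2 in
      (d : Ω → Ω → W) → IsMetric d
    → (σ : Fin ℓ → Permutation′ n) → (∀ z → MinWeightMatching d z (σ z))
    → (cl : Clustering) → OptimalBalanced d cl
    → let open Graph cl σ in
      (c₀ : Fin k) → Σ Ω (λ p → cl p ≡ c₀)
    → (α β : Fin k) (π₁ : Path c₀ AnyEdge α β)
    → (∀ (π′ : Path c₀ AnyEdge α β) → colorSwitches (edges π₁) ≤ colorSwitches (edges π′))
    → (pre seg post : List Edge) (z : Fin ℓ)
    → edges π₁ ≡ pre ++ seg ++ post → MaximalBlock pre seg post z
    → (u w : Fin k) → Walk u seg w
    → (πh : Path c₀ (ColorIs z) u w)
    → (∀ (π′ : Path c₀ (ColorIs z) u w) → switches (edges πh) ≤ switches (edges π′))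
    → switches (edges πh) ≡ 0
lemma17 S ℓ n k ℓ≥2 _ _ σ _ cl (balanced , _) c₀ _ _ _ _ _ _ _ _ _ _ _ _ _ _ πh minimal =
  n≤0⇒n≡0 (decidable-stable (switches (edges πh) ≤? 0) (do
    zeroWalk ← colorWalk⇒¬¬zeroWalk balanced (walk πh) (allowed πh)
    let (π′ , π′-switch-free) = zeroWalk⇒switchFreePath (source-inĈ (edges πh) (inĈ πh)) zeroWalk
    pure (subst (switches (edges πh) ≤_) π′-switch-free (minimal π′))))
  where
  open Clusters S ℓ n k ℓ≥2 cl
  open G₁ σ
  open Setting.Graph S ℓ n k ℓ≥2 cl σ
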